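{- Let $k,m,n\in\mathbb{N}$ with $k,n\ge 3$ and $m\ge 2$, and let $LP_{n,m}$ be any long brush graph. Then $LP_{n,m}$ is $k$-distance magic if and only if $m(m-1)\le 2n$ and $k=n$.
   Context: All graphs are finite, simple and undirected; $d(u,v)$ is graph distance. For $u\in V(G)$ and $k\in\mathbb{N}$, $\partial N_k(u)=\{v\in V(G): d(u,v)=k\}$. For a graph $G$ of order $p\ge3$, a $k$-distance magic labeling ($k$-DML) is a bijection $f:V(G)\to\{1,\dots,p\}$ together with a constant $M$ such that $\sum_{w\in\partial N_k(u)} f(w)=M$ for every vertex $u$ with $\partial N_k(u)\neq\emptyset$; moreover $G$ is required to contain at least one pair of vertices at distance $k$. $G$ is $k$-distance magic if it has a $k$-DML. A long brush $LP_{n,m}$ ($m,n\in\mathbb{N}$, $m+n\ge3$) is a graph with vertex set $\{u_1,\dots,u_n,v_1,\dots,v_m\}$ whose edges are the path edges $u_iu_{i+1}$ ($1\le i<n$), the edges $u_1v_i$ ($1\le i\le m$), and an arbitrary set of edges among $v_1,\dots,v_m$ (so the induced subgraph $\langle v_1,\dots,v_m\rangle$ is arbitrary). -}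

module Defs where

open import Data.Nat using (ℕ; zero; suc; _+_; _≤_; _<_; _≡ᵇ_)
open import Data.Bool using (Bool; true; false; _∧_; _∨_; not; if_then_else_)
open import Data.Fin using (Fin; toℕ; splitAt)
open import Data.List using (List; []; _∷_; map; upTo; allFin)
open import Data.Bool.ListAction using (any)
open import Data.Nat.ListAction using (sum)
open import Data.Sum using (_⊎_; inj₁; inj₂)
open import Data.Product using (Σ; _×_; _,_; ∃; ∃-syntax)
open import Function.Definitions using (Bijective)
open import Relation.Binary.PropositionalEquality using (_≡_)

record Graph : Set where
  field
    order : ℕ
    adj   : Fin order → Fin order → Bool
open Graph public

module _ (G : Graph) where
  private V = Fin (order G)

  walk : ℕ → V → V → Bool
  walk zero    x y = toℕ x ≡ᵇ toℕ y
  walk (suc j) x y = any (λ w → adj G x w ∧ walk j w y) (allFin (order G))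

  distAt : V → V → ℕ → Bool
  distAt x y k = walk k x y ∧ not (any (λ j → walk j x y) (upTo k))

  sphereNonempty : V → ℕ → Bool
  sphereNonempty u k = any (λ w → distAt u w k) (allFin (order G))

  sphereSum : (V → ℕ) → V → ℕ → ℕ
  sphereSum f u k =
    sum (map (λ w → if distAt u w k then f w else 0) (allFin (order G)))

  -- the labeling associated to a bijection g : V → Fin p is  w ↦ toℕ (g w) + 1 ∈ {1,…,p}
  label : (V → V) → V → ℕ
  label g w = suc (toℕ (g w))

  IsKDML : ℕ → (V → V) → ℕ → Set
  IsKDML k g M =
    Bijective _≡_ _≡_ g ×
    ((u : V) → sphereNonempty u k ≡ true → sphereSum (label g) u k ≡ M)

  KDistanceMagic : ℕ → Set
  KDistanceMagic k =
    (3 ≤ order G) ×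
    (∃[ x ] ∃[ y ] distAt x y k ≡ true) ×
    (∃[ g ] ∃[ M ] IsKDML k g M)

-- Long brush LP_{n,m}: vertices Fin (n + m); inj₁ i ↦ u_{i+1}, inj₂ j ↦ v_{j+1}.
-- E is the (arbitrary) edge relation among v_1,…,v_m.
lpAdj : (n m : ℕ) → (Fin m → Fin m → Bool) → Fin (n + m) → Fin (n + m) → Bool
lpAdj n m E x y with splitAt n x | splitAt n y
... | inj₁ i | inj₁ i' = (toℕ i' ≡ᵇ suc (toℕ i)) ∨ (toℕ i ≡ᵇ suc (toℕ i'))
... | inj₁ i | inj₂ _  = toℕ i ≡ᵇ 0
... | inj₂ _ | inj₁ i' = toℕ i' ≡ᵇ 0
... | inj₂ j | inj₂ j' = E j j'

LP : (n m : ℕ) → (Fin m → Fin m → Bool) → Graph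
LP n m E = record { order = n + m ; adj = lpAdj n m E }

-- Give u_i height i and every v_j height 0. An edge changes the height by at most one, and the
-- path u_1 … u_n together with the edges at u_1 attains this bound, so d(v_j, u_i) = d(u_i, v_j) = i
-- and d(u_1, u_i) = i - 1, while two path vertices are at distance < n and two v's at distance ≤ 2.
-- Hence distances ≥ 3 are at most n, and for 3 ≤ k < n the k-spheres of v_1 and of u_1 are {u_k}
-- and {u_{k+1}}, which forces equal labels on u_k and u_{k+1}. For k = n the n-sphere of v_1 is
-- {u_n} and that of u_n is {v_1, …, v_m}, so m distinct labels, whose sum is at least m(m+1)/2,
-- add up to a single label ≤ n + m; this is m(m-1) ≤ 2n. Conversely, label v_j by j and u_i by
-- m + i, then swap the label of u_n with m(m+1)/2: every nonempty n-sphere then sums to m(m+1)/2.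

module Submission where

open import Defs
open import Data.Bool using (Bool; true; false; _∧_; _∨_; not; if_then_else_)
open import Data.Bool.ListAction using (any)
open import Data.Bool.Properties using (T-≡; ¬-not; not-injective; ∨-zeroʳ)
open import Data.Fin using (Fin; toℕ; _↑ˡ_; _↑ʳ_; fromℕ; fromℕ<; splitAt) renaming (zero to fzero; suc to fsuc)
open import Data.Fin.Permutation using (Permutation; _⟨$⟩ʳ_; _∘ₚ_; transpose; cast-id)
import Data.Fin.Permutation.Components as PC
import Data.Fin.Properties as Fin
open import Data.List using ([]; _∷_; upTo; allFin; tabulate; length)
open import Data.List.Membership.Propositional using (_∈_; lose; find)
open import Data.List.Membership.Propositional.Properties using (∈-upTo⁺; ∈-upTo⁻; ∈-allFin)
open import Data.List.Properties using (map-tabulate; tabulate-cong; length-tabulate)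
open import Data.List.Relation.Unary.All as All using (All; _∷_)
open import Data.List.Relation.Unary.AllPairs using (_∷_)
open import Data.List.Relation.Unary.Any using (here; there)
open import Data.List.Relation.Unary.Any.Properties using (any⁺; any⁻)
open import Data.List.Relation.Unary.Unique.Propositional using (Unique)
import Data.List.Relation.Unary.Unique.Propositional.Properties as Unique
open import Data.Nat using (ℕ; zero; suc; _+_; _*_; _∸_; _≤_; _<_; _≡ᵇ_; ∣_-_∣; z≤n; s≤s; s≤s⁻¹; z<s)
open import Data.Nat.ListAction using (sum)
open import Data.Nat.Properties
open import Algebra.Properties.CommutativeSemigroup +-commutativeSemigroup using (x∙yz≈y∙xz)
open import Data.List.Membership.DecPropositional _≟_ using (_∈?_)
open import Data.Nat.Solver using (module +-*-Solver)
open import Data.Product as Product using (_×_; _,_; ∃-syntax; proj₁; proj₂)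
open import Data.Sum as Sum using (_⊎_; inj₁; inj₂; [_,_]′)
open import Data.Sum.Algebra using (⊎-comm)
open import Function.Base using (_∘_; const; _∋_)
open import Function.Bundles using (Equivalence; Bijection; _⇔_; mk⇔)
open import Function.Construct.Composition using (_↔-∘_)
open import Function.Construct.Symmetry using (↔-sym)
open import Function.Definitions using (Injective)
open import Function.Properties.Inverse using (↔⇒⤖)
open import Relation.Binary.PropositionalEquality
open import Relation.Nullary using (¬_; contradiction; yes; no)
open import Relation.Nullary.Decidable using (dec-true; dec-false)

open Equivalence using (to; from)
open +-*-Solver

module _ {A : Set} (p : A → Bool) where

  any-≡true⁺ : ∀ {x xs} → x ∈ xs → p x ≡ true → any p xs ≡ true
  any-≡true⁺ x∈xs px = to T-≡ (any⁺ p (lose x∈xs (from T-≡ px)))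

  any-≡true⁻ : ∀ xs → any p xs ≡ true → ∃[ x ] (x ∈ xs × p x ≡ true)
  any-≡true⁻ xs e with x , x∈xs , px ← find (any⁻ p xs (from T-≡ e)) = x , x∈xs , to T-≡ px

∧-≡true⁻ : ∀ {a b} → a ∧ b ≡ true → a ≡ true × b ≡ true
∧-≡true⁻ {true} e = refl , e

∨-≡true⁻ : ∀ {a b} → a ∨ b ≡ true → a ≡ true ⊎ b ≡ true
∨-≡true⁻ {true}  _ = inj₁ refl
∨-≡true⁻ {false} e = inj₂ e

≡ᵇ-true⁺ : ∀ {m n} → m ≡ n → (m ≡ᵇ n) ≡ true
≡ᵇ-true⁺ {m} {n} m≡n = to T-≡ (≡⇒≡ᵇ m n m≡n)

≡ᵇ-true⁻ : ∀ {m n} → (m ≡ᵇ n) ≡ true → m ≡ n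
≡ᵇ-true⁻ {m} {n} e = ≡ᵇ⇒≡ m n (from T-≡ e)

∣n-1+n∣≡1 : ∀ n → ∣ n - suc n ∣ ≡ 1
∣n-1+n∣≡1 n = trans (m≤n⇒∣m-n∣≡n∸m (n≤1+n n)) (m+n∸n≡m 1 n)

sum-tabulate-zero : ∀ {N} {f : Fin N → ℕ} → (∀ i → f i ≡ 0) → sum (tabulate f) ≡ 0
sum-tabulate-zero {zero}  f≡0 = refl
sum-tabulate-zero {suc N} f≡0 rewrite f≡0 fzero = sum-tabulate-zero (f≡0 ∘ fsuc)

sum-tabulate-single : ∀ {N} {f : Fin N → ℕ} i₀ → (∀ i → i ≢ i₀ → f i ≡ 0) →
                      sum (tabulate f) ≡ f i₀
sum-tabulate-single {suc N} {f} fzero f≡0 =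
  trans (cong (f fzero +_) (sum-tabulate-zero (λ i → f≡0 (fsuc i) λ ()))) (+-identityʳ (f fzero))
sum-tabulate-single {suc N} (fsuc i₀) f≡0 rewrite f≡0 fzero (λ ()) =
  sum-tabulate-single i₀ (λ i i≢i₀ → f≡0 (fsuc i) (i≢i₀ ∘ Fin.suc-injective))

sum-tabulate-suc : ∀ {N} (f : Fin N → ℕ) → sum (tabulate (λ i → suc (f i))) ≡ N + sum (tabulate f)
sum-tabulate-suc {zero}  f = refl
sum-tabulate-suc {suc N} f =
  cong suc (trans (cong (f fzero +_) (sum-tabulate-suc (f ∘ fsuc))) (x∙yz≈y∙xz (f fzero) N _))

sum-tabulate-↑ : ∀ M {N} (f : Fin (M + N) → ℕ) →
                 sum (tabulate f) ≡ sum (tabulate (f ∘ (_↑ˡ N))) + sum (tabulate (f ∘ (M ↑ʳ_)))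
sum-tabulate-↑ zero    f = refl
sum-tabulate-↑ (suc M) f =
  trans (cong (f fzero +_) (sum-tabulate-↑ M (f ∘ fsuc))) (sym (+-assoc (f fzero) _ _))

sum-tabulate-toℕ : ∀ N → 2 * sum (tabulate {n = N} toℕ) ≡ N * (N ∸ 1)
sum-tabulate-toℕ zero    = refl
sum-tabulate-toℕ (suc N) = begin
  2 * sum (tabulate {n = suc N} toℕ)     ≡⟨ cong (2 *_) (sum-tabulate-suc {N} toℕ) ⟩
  2 * (N + sum (tabulate {n = N} toℕ))   ≡⟨ *-distribˡ-+ 2 N _ ⟩
  2 * N + 2 * sum (tabulate {n = N} toℕ) ≡⟨ cong (2 * N +_) (sum-tabulate-toℕ N) ⟩
  2 * N + N * (N ∸ 1)                    ≡⟨ step N ⟩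
  suc N * N                              ∎
  where
  open ≡-Reasoning
  step : ∀ N → 2 * N + N * (N ∸ 1) ≡ suc N * N
  step zero    = refl
  step (suc N) = solve 1 (λ N → con 2 :* (con 1 :+ N) :+ (con 1 :+ N) :* N
                             := (con 2 :+ N) :* (con 1 :+ N)) refl N

0<sum-tabulate-toℕ : ∀ {N} → 2 ≤ N → 0 < sum (tabulate {n = N} toℕ)
0<sum-tabulate-toℕ {suc zero}    (s≤s ())
0<sum-tabulate-toℕ {suc (suc N)} _ = z<s

∈⇒≤sum : ∀ {x xs} → x ∈ xs → x ≤ sum xs
∈⇒≤sum {xs = x ∷ xs} (here refl)  = m≤m+n x (sum xs)
∈⇒≤sum {xs = y ∷ xs} (there x∈xs) = ≤-trans (∈⇒≤sum x∈xs) (m≤n+m (sum xs) y)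

Unique-remove : ∀ {x xs} → Unique xs → x ∈ xs →
  ∃[ ys ] (Unique ys × All (λ y → y ∈ xs × y ≢ x) ys ×
           length xs ≡ suc (length ys) × sum xs ≡ x + sum ys)
Unique-remove {xs = x ∷ ys} (x∉ys ∷ uys) (here refl) =
  ys , uys , All.tabulate (λ y∈ys → there y∈ys , ≢-sym (All.lookup x∉ys y∈ys)) , refl , refl
Unique-remove {x} {y ∷ xs} (y∉xs ∷ uxs) (there x∈xs)
  with ys , uys , ys⊆xs , len , sum≡ ← Unique-remove uxs x∈xs =
  y ∷ ys , All.map (λ (y′∈xs , _) → All.lookup y∉xs y′∈xs) ys⊆xs ∷ uys ,
  (here refl , ≢-sym (All.lookup y∉xs x∈xs) ∘ sym) ∷ All.map (Product.map₁ there) ys⊆xs ,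
  cong suc len , trans (cong (y +_) sum≡) (x∙yz≈y∙xz y x (sum ys))

Unique⇒sum-tabulate-toℕ≤sum : ∀ {xs} → Unique xs → sum (tabulate {n = length xs} toℕ) ≤ sum xs
Unique⇒sum-tabulate-toℕ≤sum {xs} uxs =
  proj₂ (bounded (suc (sum xs)) xs uxs (All.tabulate (s≤s ∘ ∈⇒≤sum)))
  where
  lower : ∀ {x N} → x < suc N → x ≢ N → x < N
  lower x<1+N x≢N = ≤∧≢⇒< (s≤s⁻¹ x<1+N) x≢N
  -- Induction on a strict upper bound N + 1: remove N if it occurs, otherwise N is a bound.
  bounded : ∀ N xs → Unique xs → All (_< N) xs →
            length xs ≤ N × sum (tabulate {n = length xs} toℕ) ≤ sum xs
  bounded zero    []      _   _        = z≤n , z≤n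
  bounded zero    (_ ∷ _) _   (() ∷ _)
  bounded (suc N) xs      uxs xs<1+N with N ∈? xs
  ... | no N∉xs = Product.map₁ m≤n⇒m≤1+n (bounded N xs uxs
          (All.tabulate λ x∈xs → lower (All.lookup xs<1+N x∈xs) λ { refl → N∉xs x∈xs }))
  ... | yes N∈xs with ys , uys , ys⊆xs , len , sum≡ ← Unique-remove uxs N∈xs
        with l≤N , ih ← bounded N ys uys
               (All.map (λ (y∈xs , y≢N) → lower (All.lookup xs<1+N y∈xs) y≢N) ys⊆xs)
        rewrite len | sum≡ =
          s≤s l≤N , ≤-trans (≤-reflexive (sum-tabulate-suc {length ys} toℕ)) (+-mono-≤ l≤N ih)

suc-toℕ-surjective : ∀ {N T} → 0 < T → T ≤ N → ∃[ c ] suc (toℕ {N} c) ≡ T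
suc-toℕ-surjective {T = suc T} _ T<N = fromℕ< T<N , cong suc (Fin.toℕ-fromℕ< T<N)

transpose-matchˡ : ∀ {N} (i j : Fin N) → PC.transpose i j i ≡ j
transpose-matchˡ i j rewrite dec-true (i Fin.≟ i) refl = refl

transpose-fixed : ∀ {N} {i j k : Fin N} → k ≢ i → k ≢ j → PC.transpose i j k ≡ k
transpose-fixed {i = i} {j} {k} k≢i k≢j
  rewrite dec-false (k Fin.≟ i) k≢i | dec-false (k Fin.≟ j) k≢j = refl

module Distance (G : Graph) where

  private
    V = Fin (order G)
    variable
      x y w w₀ : V
      i j k : ℕ

  infixr 5 _∷_
  data Walk : ℕ → V → V → Set where
    []  : Walk 0 x x
    _∷_ : adj G x w ≡ true → Walk j w y → Walk (suc j) x y

  _∷ʳ_ : Walk j x w → adj G w y ≡ true → Walk (suc j) x y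
  []       ∷ʳ wy = wy ∷ []
  (xw ∷ p) ∷ʳ wy = xw ∷ (p ∷ʳ wy)

  walk-sound : Walk j x y → walk G j x y ≡ true
  walk-sound {x = x} []         = ≡ᵇ-true⁺ {toℕ x} refl
  walk-sound (_∷_ {w = w} xw p) = any-≡true⁺ _ (∈-allFin w) (cong₂ _∧_ xw (walk-sound p))

  walk-complete : ∀ j x y → walk G j x y ≡ true → Walk j x y
  walk-complete zero    x y e with refl ← Fin.toℕ-injective (≡ᵇ-true⁻ {toℕ x} e) = []
  walk-complete (suc j) x y e with w , _ , p ← any-≡true⁻ _ (allFin (order G)) e =
    proj₁ (∧-≡true⁻ p) ∷ walk-complete j w y (proj₂ (∧-≡true⁻ p))

  Lipschitz : (V → ℕ) → Set
  Lipschitz h = ∀ x y → adj G x y ≡ true → ∣ h x - h y ∣ ≤ 1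

  Walk-Lipschitz : ∀ h → Lipschitz h → Walk j x y → ∣ h x - h y ∣ ≤ j
  Walk-Lipschitz {y = y} h h-lip [] = ≤-reflexive (∣n-n∣≡0 (h y))
  Walk-Lipschitz {x = x} {y} h h-lip (_∷_ {w = w} xw p) =
    ≤-trans (∣-∣-triangle (h x) (h w) (h y)) (+-mono-≤ (h-lip x w xw) (Walk-Lipschitz h h-lip p))

  record IsDistance (x y : V) (k : ℕ) : Set where
    field
      shortest : Walk k x y
      minimal  : ∀ {j} → Walk j x y → k ≤ j

  open IsDistance public

  IsDistance-unique : IsDistance x y i → IsDistance x y j → i ≡ j
  IsDistance-unique p q = ≤-antisym (minimal p (shortest q)) (minimal q (shortest p))

  IsDistance-Lipschitz : ∀ h → Lipschitz h → ∣ h x - h y ∣ ≡ k → Walk k x y → IsDistance x y k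
  IsDistance-Lipschitz h h-lip refl p = record { shortest = p ; minimal = Walk-Lipschitz h h-lip }

  distAt⇒IsDistance : ∀ x y k → distAt G x y k ≡ true → IsDistance x y k
  distAt⇒IsDistance x y k d = record
    { shortest = walk-complete k x y (proj₁ (∧-≡true⁻ d))
    ; minimal  = λ p → ≮⇒≥ λ j<k → contradiction
        (trans (sym (any-≡true⁺ _ (∈-upTo⁺ j<k) (walk-sound p))) (not-injective (proj₂ (∧-≡true⁻ d))))
        λ ()
    }

  IsDistance⇒distAt : IsDistance x y k → distAt G x y k ≡ true
  IsDistance⇒distAt {x} {y} {k} d rewrite walk-sound (shortest d) = cong not (¬-not λ shorter →
    let j , j∈ , p = any-≡true⁻ (λ i → walk G i x y) (upTo k) shorter
    in <⇒≱ (∈-upTo⁻ j∈) (minimal d (walk-complete j x y p)))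

  sphereNonempty-intro : IsDistance x w k → sphereNonempty G x k ≡ true
  sphereNonempty-intro {w = w} d = any-≡true⁺ _ (∈-allFin w) (IsDistance⇒distAt d)

  sphereNonempty-witness : sphereNonempty G x k ≡ true → ∃[ w ] IsDistance x w k
  sphereNonempty-witness {x} {k} ne with w , _ , d ← any-≡true⁻ _ (allFin (order G)) ne =
    w , distAt⇒IsDistance x w k d

  sphereTerm : (V → ℕ) → V → ℕ → V → ℕ
  sphereTerm f x k w = if distAt G x w k then f w else 0

  sphereSum-tabulate : ∀ f x k → sphereSum G f x k ≡ sum (tabulate (sphereTerm f x k))
  sphereSum-tabulate f x k = cong sum (map-tabulate (λ w → w) (sphereTerm f x k))

  sphereTerm-in : ∀ f → IsDistance x w k → sphereTerm f x k w ≡ f w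
  sphereTerm-in f d rewrite IsDistance⇒distAt d = refl

  sphereTerm-out : ∀ f → ¬ IsDistance x w k → sphereTerm f x k w ≡ 0
  sphereTerm-out {x} {w} {k} f ¬d rewrite ¬-not (¬d ∘ distAt⇒IsDistance x w k) = refl

  sphereSum-singleton : ∀ f → (∀ {w} → IsDistance x w k → w ≡ w₀) → IsDistance x w₀ k →
                        sphereSum G f x k ≡ f w₀
  sphereSum-singleton {x} {k} {w₀} f only d = begin
    sphereSum G f x k                 ≡⟨ sphereSum-tabulate f x k ⟩
    sum (tabulate (sphereTerm f x k)) ≡⟨ sum-tabulate-single w₀ outside ⟩
    sphereTerm f x k w₀               ≡⟨ sphereTerm-in f d ⟩
    f w₀                              ∎
    where
    open ≡-Reasoning
    outside : ∀ w → w ≢ w₀ → sphereTerm f x k w ≡ 0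
    outside _ w≢w₀ = sphereTerm-out f (w≢w₀ ∘ only)

  label-injective : ∀ {g} → Injective _≡_ _≡_ g → label G g x ≡ label G g y → x ≡ y
  label-injective g-inj = g-inj ∘ Fin.toℕ-injective ∘ suc-injective

  IsKDML-singleton : ∀ {g M} → IsKDML G k g M → (∀ {w} → IsDistance x w k → w ≡ w₀) →
                     IsDistance x w₀ k → label G g w₀ ≡ M
  IsKDML-singleton {x = x} {g = g} (_ , magic) only d =
    trans (sym (sphereSum-singleton (label G g) only d)) (magic x (sphereNonempty-intro d))

module LongBrush (n₁ m : ℕ) (E : Fin m → Fin m → Bool) where

  n : ℕ
  n = suc n₁

  G : Graph
  G = LP n m E

  open Distance G

  private
    variable
      a b : Fin n
      j j′ : Fin m
      w x y : Fin (n + m)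
      k : ℕ

  -- u a and v j are the paper's u_{a+1} and v_{j+1}.
  u : Fin n → Fin (n + m)
  u a = a ↑ˡ m

  v : Fin m → Fin (n + m)
  v j = n ↑ʳ j

  last : Fin n
  last = fromℕ n₁

  n≡1+last : n ≡ suc (toℕ last)
  n≡1+last = cong suc (sym (Fin.toℕ-fromℕ n₁))

  data Vertex : Fin (n + m) → Set where
    path  : ∀ a → Vertex (u a)
    brush : ∀ j → Vertex (v j)

  vertex : ∀ x → Vertex x
  vertex x with splitAt n x in eq
  ... | inj₁ a = subst Vertex (Fin.splitAt⁻¹-↑ˡ eq) (path a)
  ... | inj₂ j = subst Vertex (Fin.splitAt⁻¹-↑ʳ eq) (brush j)

  u≢v : u a ≢ v j
  u≢v {a} {j} u≡v
    with () ← trans (sym (Fin.splitAt-↑ˡ n a m)) (trans (cong (splitAt n) u≡v) (Fin.splitAt-↑ʳ n m j))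

  adj-u-u : ∀ a b → adj G (u a) (u b) ≡ ((toℕ b ≡ᵇ suc (toℕ a)) ∨ (toℕ a ≡ᵇ suc (toℕ b)))
  adj-u-u a b rewrite Fin.splitAt-↑ˡ n a m | Fin.splitAt-↑ˡ n b m = refl

  adj-u-v : ∀ a j → adj G (u a) (v j) ≡ (toℕ a ≡ᵇ 0)
  adj-u-v a j rewrite Fin.splitAt-↑ˡ n a m | Fin.splitAt-↑ʳ n m j = refl

  adj-v-u : ∀ j a → adj G (v j) (u a) ≡ (toℕ a ≡ᵇ 0)
  adj-v-u j a rewrite Fin.splitAt-↑ʳ n m j | Fin.splitAt-↑ˡ n a m = refl

  adj-u-u⁻ : ∀ a b → adj G (u a) (u b) ≡ true → toℕ b ≡ suc (toℕ a) ⊎ toℕ a ≡ suc (toℕ b)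
  adj-u-u⁻ a b e = Sum.map ≡ᵇ-true⁻ ≡ᵇ-true⁻
    (∨-≡true⁻ {toℕ b ≡ᵇ suc (toℕ a)} {toℕ a ≡ᵇ suc (toℕ b)} (trans (sym (adj-u-u a b)) e))

  adj-u-suc : toℕ b ≡ suc (toℕ a) → adj G (u a) (u b) ≡ true × adj G (u b) (u a) ≡ true
  adj-u-suc {b} {a} b≡1+a =
    trans (adj-u-u a b) (cong (_∨ (toℕ a ≡ᵇ suc (toℕ b))) (≡ᵇ-true⁺ b≡1+a)) ,
    trans (adj-u-u b a) (trans (cong ((toℕ a ≡ᵇ suc (toℕ b)) ∨_) (≡ᵇ-true⁺ b≡1+a)) (∨-zeroʳ _))

  height : Fin (n + m) → ℕ
  height x = [ suc ∘ toℕ , const 0 ]′ (splitAt n x)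

  height-u : ∀ a → height (u a) ≡ suc (toℕ a)
  height-u a rewrite Fin.splitAt-↑ˡ n a m = refl

  height-v : ∀ j → height (v j) ≡ 0
  height-v j rewrite Fin.splitAt-↑ʳ n m j = refl

  height-Lipschitz : Lipschitz height
  height-Lipschitz x y xy with vertex x | vertex y
  ... | path a | path b rewrite height-u a | height-u b with adj-u-u⁻ a b xy
  ...   | inj₁ b≡1+a rewrite b≡1+a = ≤-reflexive (∣n-1+n∣≡1 (toℕ a))
  ...   | inj₂ a≡1+b rewrite a≡1+b =
          ≤-reflexive (trans (∣-∣-comm (suc (toℕ b)) (toℕ b)) (∣n-1+n∣≡1 (toℕ b)))
  height-Lipschitz _ _ xy | path a | brush j
    rewrite height-u a | height-v j | ≡ᵇ-true⁻ {toℕ a} (trans (sym (adj-u-v a j)) xy) = ≤-refl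
  height-Lipschitz _ _ xy | brush j | path a
    rewrite height-v j | height-u a | ≡ᵇ-true⁻ {toℕ a} (trans (sym (adj-v-u j a)) xy) = ≤-refl
  height-Lipschitz _ _ xy | brush j | brush j′ rewrite height-v j | height-v j′ = z≤n

  path-walks : ∀ l a b → toℕ b ≡ l + toℕ a → Walk l (u a) (u b) × Walk l (u b) (u a)
  path-walks zero    a b b≡a rewrite Fin.toℕ-injective b≡a = [] , []
  path-walks (suc l) a b b≡ =
    proj₁ (adj-u-suc c≡) ∷ proj₁ c↔b , proj₂ c↔b ∷ʳ proj₂ (adj-u-suc c≡)
    where
    1+a<n : suc (toℕ a) < n
    1+a<n = ≤-<-trans (s≤s (m≤n+m (toℕ a) l)) (subst (_< n) b≡ (Fin.toℕ<n b))
    c : Fin n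
    c = fromℕ< 1+a<n
    c≡ : toℕ c ≡ suc (toℕ a)
    c≡ = Fin.toℕ-fromℕ< 1+a<n
    c↔b : Walk l (u c) (u b) × Walk l (u b) (u c)
    c↔b = path-walks l c b (trans b≡ (trans (sym (+-suc l (toℕ a))) (cong (l +_) (sym c≡))))

  path-from-u₀ : ∀ a → Walk (toℕ a) (u fzero) (u a) × Walk (toℕ a) (u a) (u fzero)
  path-from-u₀ a = path-walks (toℕ a) fzero a (sym (+-identityʳ (toℕ a)))

  IsDistance-v-u : ∀ j a → k ≡ suc (toℕ a) → IsDistance (v j) (u a) k
  IsDistance-v-u j a refl =
    IsDistance-Lipschitz height height-Lipschitz (cong₂ ∣_-_∣ (height-v j) (height-u a))
      (adj-v-u j fzero ∷ proj₁ (path-from-u₀ a))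

  IsDistance-u-v : ∀ a j → k ≡ suc (toℕ a) → IsDistance (u a) (v j) k
  IsDistance-u-v a j refl =
    IsDistance-Lipschitz height height-Lipschitz (cong₂ ∣_-_∣ (height-u a) (height-v j))
      (proj₂ (path-from-u₀ a) ∷ʳ adj-u-v fzero j)

  IsDistance-u₀-u : ∀ b → k ≡ toℕ b → IsDistance (u fzero) (u b) k
  IsDistance-u₀-u b refl =
    IsDistance-Lipschitz height height-Lipschitz (cong₂ ∣_-_∣ (height-u fzero) (height-u b))
      (proj₁ (path-from-u₀ b))

  IsDistance-u-u⇒<n : IsDistance (u a) (u b) k → k < n
  IsDistance-u-u⇒<n {a} {b} d with ≤-total (toℕ a) (toℕ b)
  ... | inj₁ a≤b = ≤-<-trans (minimal d (proj₁ (path-walks _ a b (sym (m∸n+n≡m a≤b)))))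
                             (≤-<-trans (m∸n≤m (toℕ b) (toℕ a)) (Fin.toℕ<n b))
  ... | inj₂ b≤a = ≤-<-trans (minimal d (proj₂ (path-walks _ b a (sym (m∸n+n≡m b≤a)))))
                             (≤-<-trans (m∸n≤m (toℕ a) (toℕ b)) (Fin.toℕ<n a))

  IsDistance-v-v⇒≤2 : IsDistance (v j) (v j′) k → k ≤ 2
  IsDistance-v-v⇒≤2 {j} {j′} d =
    minimal d (adj-v-u j fzero ∷ (Walk 1 (u fzero) (v j′) ∋ adj-u-v fzero j′ ∷ []))

  IsDistance⇒≤n : 3 ≤ k → IsDistance x y k → k ≤ n
  IsDistance⇒≤n {x = x} {y} k≥3 d with vertex x | vertex y
  ... | path a  | path b  = <⇒≤ (IsDistance-u-u⇒<n d)
  ... | path a  | brush j = ≤-trans (≤-reflexive (IsDistance-unique d (IsDistance-u-v a j refl))) (Fin.toℕ<n a)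
  ... | brush j | path a  = ≤-trans (≤-reflexive (IsDistance-unique d (IsDistance-v-u j a refl))) (Fin.toℕ<n a)
  ... | brush _ | brush _ = contradiction (IsDistance-v-v⇒≤2 d) (<⇒≱ k≥3)

  sphere-v : 3 ≤ k → k ≡ suc (toℕ a) → IsDistance (v j) w k → w ≡ u a
  sphere-v {j = j} {w} k≥3 k≡1+a d with vertex w
  ... | path b  = cong u (Fin.toℕ-injective (suc-injective
                    (trans (sym (IsDistance-unique d (IsDistance-v-u j b refl))) k≡1+a)))
  ... | brush _ = contradiction (IsDistance-v-v⇒≤2 d) (<⇒≱ k≥3)

  sphere-u₀ : 2 ≤ k → k ≡ toℕ b → IsDistance (u fzero) w k → w ≡ u b
  sphere-u₀ {w = w} k≥2 k≡b d with vertex w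
  ... | path c  = cong u (Fin.toℕ-injective (trans (sym (IsDistance-unique d (IsDistance-u₀-u c refl))) k≡b))
  ... | brush j = contradiction (subst (2 ≤_) (IsDistance-unique d (IsDistance-u-v fzero j refl)) k≥2)
                                λ { (s≤s ()) }

  sphere-u : IsDistance (u a) w n → n ≡ suc (toℕ a)
  sphere-u {a} {w} d with vertex w
  ... | path _  = contradiction (IsDistance-u-u⇒<n d) (<-irrefl refl)
  ... | brush j = IsDistance-unique d (IsDistance-u-v a j refl)

  sphereSum-u : ∀ f → n ≡ suc (toℕ a) → sphereSum G f (u a) n ≡ sum (tabulate (f ∘ v))
  sphereSum-u {a} f n≡1+a = begin
    sphereSum G f (u a) n                           ≡⟨ sphereSum-tabulate f (u a) n ⟩
    sum (tabulate F)                                ≡⟨ sum-tabulate-↑ n F ⟩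
    sum (tabulate (F ∘ u)) + sum (tabulate (F ∘ v)) ≡⟨ cong₂ _+_ (sum-tabulate-zero on-path)
                                                                 (cong sum (tabulate-cong on-brush)) ⟩
    sum (tabulate (f ∘ v))                          ∎
    where
    open ≡-Reasoning
    F : Fin (n + m) → ℕ
    F = sphereTerm f (u a) n
    on-path : ∀ b → F (u b) ≡ 0
    on-path b = sphereTerm-out f (<-irrefl refl ∘ IsDistance-u-u⇒<n {a} {b})
    on-brush : ∀ j → F (v j) ≡ f (v j)
    on-brush j = sphereTerm-in f (IsDistance-u-v a j n≡1+a)

  IsKDML⇒n≤k : ∀ {g M} → Fin m → 3 ≤ k → IsKDML G k g M → n ≤ k
  IsKDML⇒n≤k {suc k} {g} {M} j₀ k≥3 dml@((g-inj , _) , _) = ≮⇒≥ λ 1+k<n →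
    let a = fromℕ< (<⇒≤ 1+k<n)
        b = fromℕ< 1+k<n
        a≡k = Fin.toℕ-fromℕ< (<⇒≤ 1+k<n)
        b≡1+k = Fin.toℕ-fromℕ< 1+k<n
        label-a : label G g (u a) ≡ M
        label-a = IsKDML-singleton dml (sphere-v k≥3 (cong suc (sym a≡k)))
                                       (IsDistance-v-u j₀ a (cong suc (sym a≡k)))
        label-b : label G g (u b) ≡ M
        label-b = IsKDML-singleton dml (sphere-u₀ (≤-trans (n≤1+n 2) k≥3) (sym b≡1+k))
                                       (IsDistance-u₀-u b (sym b≡1+k))
        a≡b = Fin.↑ˡ-injective m a b (label-injective g-inj (trans label-a (sym label-b)))
    in 1+n≢n (trans (sym b≡1+k) (trans (cong toℕ (sym a≡b)) a≡k))

  IsKDML⇒bound : ∀ {g M} → Fin m → 3 ≤ n → IsKDML G n g M → m * (m ∸ 1) ≤ 2 * n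
  IsKDML⇒bound {g} {M} j₀ n≥3 dml@((g-inj , _) , magic) = begin
    m * (m ∸ 1)                    ≡⟨ sum-tabulate-toℕ m ⟨
    2 * sum (tabulate {n = m} toℕ) ≤⟨ *-monoʳ-≤ 2 distinct ⟩
    2 * sum (tabulate t)           ≤⟨ *-monoʳ-≤ 2 (+-cancelˡ-≤ m _ _ m+Σt≤m+n) ⟩
    2 * n                          ∎
    where
    open ≤-Reasoning
    t : Fin m → ℕ
    t = toℕ ∘ g ∘ v
    distinct : sum (tabulate {n = m} toℕ) ≤ sum (tabulate t)
    distinct = subst (λ l → sum (tabulate {n = l} toℕ) ≤ sum (tabulate t)) (length-tabulate t)
      (Unique⇒sum-tabulate-toℕ≤sum (Unique.tabulate⁺ (Fin.↑ʳ-injective n _ _ ∘ g-inj ∘ Fin.toℕ-injective)))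
    m+Σt≡label : m + sum (tabulate t) ≡ label G g (u last)
    m+Σt≡label = begin-equality
      m + sum (tabulate t)               ≡⟨ sum-tabulate-suc t ⟨
      sum (tabulate (label G g ∘ v))     ≡⟨ sphereSum-u (label G g) n≡1+last ⟨
      sphereSum G (label G g) (u last) n ≡⟨ magic (u last)
                                              (sphereNonempty-intro (IsDistance-u-v last j₀ n≡1+last)) ⟩
      M                                  ≡⟨ IsKDML-singleton dml (sphere-v n≥3 n≡1+last)
                                                                 (IsDistance-v-u j₀ last n≡1+last) ⟨
      label G g (u last)                 ∎
    m+Σt≤m+n : m + sum (tabulate t) ≤ m + n
    m+Σt≤m+n = begin
      m + sum (tabulate t) ≡⟨ m+Σt≡label ⟩
      label G g (u last)   ≤⟨ Fin.toℕ<n (g (u last)) ⟩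
      n + m                ≡⟨ +-comm n m ⟩
      m + n                ∎

  blocks : Permutation (n + m) (n + m)
  blocks = cast-id (+-comm m n) ↔-∘
           (↔-sym (Fin.+↔⊎ {m} {n}) ↔-∘ (⊎-comm (Fin n) (Fin m) ↔-∘ Fin.+↔⊎ {n} {m}))

  toℕ-blocks-u : ∀ a → toℕ (blocks ⟨$⟩ʳ u a) ≡ m + toℕ a
  toℕ-blocks-u a rewrite Fin.splitAt-↑ˡ n a m = trans (Fin.toℕ-cast _ (m ↑ʳ a)) (Fin.toℕ-↑ʳ m a)

  toℕ-blocks-v : ∀ j → toℕ (blocks ⟨$⟩ʳ v j) ≡ toℕ j
  toℕ-blocks-v j rewrite Fin.splitAt-↑ʳ n m j = trans (Fin.toℕ-cast _ (j ↑ˡ n)) (Fin.toℕ-↑ˡ j n)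

  swapped-blocks : Fin n → Permutation (n + m) (n + m)
  swapped-blocks c = transpose (u last) (u c) ∘ₚ blocks

  label-v : ∀ c j → label G (swapped-blocks c ⟨$⟩ʳ_) (v j) ≡ suc (toℕ j)
  label-v c j = cong suc (trans (cong (toℕ ∘ (blocks ⟨$⟩ʳ_)) v-fixed) (toℕ-blocks-v j))
    where
    v-fixed : PC.transpose (u last) (u c) (v j) ≡ v j
    v-fixed = transpose-fixed (u≢v {last} ∘ sym) (u≢v {c} ∘ sym)

  label-last : ∀ c → label G (swapped-blocks c ⟨$⟩ʳ_) (u last) ≡ suc (m + toℕ c)
  label-last c =
    cong suc (trans (cong (toℕ ∘ (blocks ⟨$⟩ʳ_)) (transpose-matchˡ (u last) (u c))) (toℕ-blocks-u c))

  magic-labelling : 3 ≤ n → 2 ≤ m → m * (m ∸ 1) ≤ 2 * n → KDistanceMagic G n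
  magic-labelling n≥3 m≥2 bound =
    ≤-trans n≥3 (m≤m+n n m) ,
    (v j₀ , u last , IsDistance⇒distAt (IsDistance-v-u j₀ last n≡1+last)) ,
    g , m + T , Bijection.bijective (↔⇒⤖ (swapped-blocks c)) , magic
    where
    j₀ : Fin m
    j₀ = fromℕ< (≤-trans (s≤s z≤n) m≥2)
    T : ℕ
    T = sum (tabulate {n = m} toℕ)
    T≤n : T ≤ n
    T≤n = *-cancelˡ-≤ 2 (≤-trans (≤-reflexive (sum-tabulate-toℕ m)) bound)
    c : Fin n
    c = proj₁ (suc-toℕ-surjective (0<sum-tabulate-toℕ m≥2) T≤n)
    1+c≡T : suc (toℕ c) ≡ T
    1+c≡T = proj₂ (suc-toℕ-surjective (0<sum-tabulate-toℕ m≥2) T≤n)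
    g : Fin (n + m) → Fin (n + m)
    g = swapped-blocks c ⟨$⟩ʳ_
    magic : ∀ x → sphereNonempty G x n ≡ true → sphereSum G (label G g) x n ≡ m + T
    magic x ne with vertex x | sphereNonempty-witness {x} {n} ne
    ... | path a  | _ , d = begin
      sphereSum G (label G g) (u a) n    ≡⟨ sphereSum-u (label G g) (sphere-u d) ⟩
      sum (tabulate (label G g ∘ v))     ≡⟨ cong sum (tabulate-cong {n = m} (label-v c)) ⟩
      sum (tabulate {n = m} (suc ∘ toℕ)) ≡⟨ sum-tabulate-suc {m} toℕ ⟩
      m + T                              ∎
      where open ≡-Reasoning
    ... | brush j | _ = begin
      sphereSum G (label G g) (v j) n    ≡⟨ sphereSum-singleton (label G g) (sphere-v n≥3 n≡1+last)
                                                                (IsDistance-v-u j last n≡1+last) ⟩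
      label G g (u last)                 ≡⟨ label-last c ⟩
      suc (m + toℕ c)                    ≡⟨ +-suc m (toℕ c) ⟨
      m + suc (toℕ c)                    ≡⟨ cong (m +_) 1+c≡T ⟩
      m + T                              ∎
      where open ≡-Reasoning

theorem3p1 : (k m n : ℕ) → 3 ≤ k → 3 ≤ n → 2 ≤ m →
    (E : Fin m → Fin m → Bool) →
    (∀ i j → E i j ≡ E j i) → (∀ i → E i i ≡ false) →
    KDistanceMagic (LP n m E) k ⇔ ((m * (m ∸ 1) ≤ 2 * n) × (k ≡ n))
theorem3p1 k m zero     _   ()  _   E _ _
theorem3p1 k m (suc n₁) k≥3 n≥3 m≥2 E _ _ = mk⇔ magic⇒ ⇐magic
  where
  open LongBrush n₁ m E
  open Distance G
  j₀ : Fin m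
  j₀ = fromℕ< (≤-trans (s≤s z≤n) m≥2)
  magic⇒ : KDistanceMagic G k → m * (m ∸ 1) ≤ 2 * n × k ≡ n
  magic⇒ (_ , (x , y , d) , _ , _ , dml)
    with refl ← ≤-antisym (IsDistance⇒≤n k≥3 (distAt⇒IsDistance x y k d)) (IsKDML⇒n≤k j₀ k≥3 dml) =
    IsKDML⇒bound j₀ k≥3 dml , refl
  ⇐magic : m * (m ∸ 1) ≤ 2 * n × k ≡ n → KDistanceMagic G k
  ⇐magic (bound , refl) = magic-labelling n≥3 m≥2 bound
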